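{- Let $P$ be a connected finite $\Gamma$-colored $d$-complete poset and let $a\in\Gamma$. Then $P$ is extendable by $a$ if and only if $L_a(P)=2$.
   Context: Dynkin diagram $\Gamma$: finite set with integers $\theta_{ab}$, $\theta_{aa}=2$, $\theta_{ab}\le0$ ($a\ne b$), $\theta_{ab}=0\iff\theta_{ba}=0$; $a\sim b$ if $a\ne b$ and $\theta_{ab}<0$. $\Gamma$-colored poset: poset with surjective $\kappa:P\to\Gamma$; $P_a=\kappa^{ -1}(a)$. Consecutive elements of color $a$: $x<y$ of color $a$, no color-$a$ element in $(x,y)$. $U(x,P)=\{y>x:\kappa(y)\sim\kappa(x)\}$, $L(x,P)=\{y<x:\kappa(y)\sim\kappa(x)\}$. $\Gamma$-colored $d$-complete: locally finite with (EC) equal colors comparable; (NA) neighbors (one covers the other) have adjacent colors; (AC) adjacent colors comparable; (ICE2) consecutive $x<y$ of color $a$ have $\sum_{z\in(x,y)}-\theta_{\kappa(z),a}=2$; (UCB1) for maximal $x$ of color $a$, $U(x,P)$ finite and $\sum_{y\in U(x,P)}-\theta_{\kappa(y),a}\le1$. $P$ is extendable by $a$ if there is a connected finite $\Gamma$-colored $d$-complete poset $P'$ such that $P$ is a filter of $P'$ and $P'\setminus P$ consists of a single element, whose color is $a$. Lower frontier census: for $b\in\Gamma$ with $y$ the minimal element of $P_b$, $L_b(P)=\sum_{x\in L(y,P)}-\theta_{\kappa(x),b}$. -}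

module Defs where

open import Data.Nat using (ℕ)
open import Data.Bool using (Bool; true; false; T; if_then_else_; _∧_; not)
open import Data.Fin using (Fin)
open import Data.Fin.Properties using () renaming (_≟_ to _≟ᶠ_)
open import Data.Integer using (ℤ; +_; -_; _+_; _<_; _≤_; _<?_)
open import Data.List using (List; foldr; allFin)
open import Data.Product using (Σ; ∃; _×_; _,_)
open import Data.Sum using (_⊎_)
open import Relation.Nullary using (¬_; Dec)
open import Relation.Nullary.Decidable using (⌊_⌋; _×-dec_; ¬?)
open import Relation.Binary.PropositionalEquality using (_≡_; _≢_)
open import Relation.Binary.Construct.Closure.ReflexiveTransitive using (Star)

record Dynkin : Set where
  field
    n       : ℕ
    θ       : Fin n → Fin n → ℤ
    θ-diag  : ∀ a → θ a a ≡ + 2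
    θ-off   : ∀ a b → a ≢ b → θ a b ≤ + 0
    θ-zero→ : ∀ a b → θ a b ≡ + 0 → θ b a ≡ + 0
    θ-zero← : ∀ a b → θ b a ≡ + 0 → θ a b ≡ + 0

module _ (Γ : Dynkin) where
  open Dynkin Γ

  Adjacent : Fin n → Fin n → Set
  Adjacent a b = (a ≢ b) × (θ a b < + 0)

  adjacent? : ∀ a b → Dec (Adjacent a b)
  adjacent? a b = ¬? (a ≟ᶠ b) ×-dec (θ a b <? + 0)

  record CPoset : Set where
    field
      size    : ℕ
      leᵇ     : Fin size → Fin size → Bool
      ≤-refl  : ∀ x → T (leᵇ x x)
      ≤-antisym : ∀ x y → T (leᵇ x y) → T (leᵇ y x) → x ≡ y
      ≤-trans : ∀ x y z → T (leᵇ x y) → T (leᵇ y z) → T (leᵇ x z)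
      κ       : Fin size → Fin n
      κ-surj  : ∀ a → ∃ λ x → κ x ≡ a

  module _ (P : CPoset) where
    open CPoset P

    _≼_ : Fin size → Fin size → Set
    x ≼ y = T (leᵇ x y)

    _≺_ : Fin size → Fin size → Set
    x ≺ y = (x ≼ y) × (x ≢ y)

    ltᵇ : Fin size → Fin size → Bool
    ltᵇ x y = leᵇ x y ∧ not ⌊ x ≟ᶠ y ⌋

    sumWhere : (Fin size → Bool) → (Fin size → ℤ) → ℤ
    sumWhere p f = foldr (λ x acc → if p x then f x + acc else acc) (+ 0) (allFin size)

    Comparable : Fin size → Fin size → Set
    Comparable x y = (x ≼ y) ⊎ (y ≼ x)

    Covers : Fin size → Fin size → Set
    Covers x y = (x ≺ y) × (∀ z → ¬ ((x ≺ z) × (z ≺ y)))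

    Connected : Set
    Connected = ∀ x y → Star Comparable x y

    EC : Set
    EC = ∀ x y → κ x ≡ κ y → Comparable x y

    NA : Set
    NA = ∀ x y → Covers x y → Adjacent (κ x) (κ y)

    AC : Set
    AC = ∀ x y → Adjacent (κ x) (κ y) → Comparable x y

    ICE2 : Set
    ICE2 = ∀ x y → x ≺ y → κ x ≡ κ y → (∀ z → x ≺ z → z ≺ y → κ z ≢ κ x) →
           sumWhere (λ z → ltᵇ x z ∧ ltᵇ z y) (λ z → - θ (κ z) (κ x)) ≡ + 2

    upperCensus : Fin size → ℤ
    upperCensus x = sumWhere (λ y → ltᵇ x y ∧ ⌊ adjacent? (κ y) (κ x) ⌋)
                             (λ y → - θ (κ y) (κ x))

    -- (UCB1)  (U(x,P) is automatically finite)
    UCB1 : Set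
    UCB1 = ∀ x → (∀ y → κ y ≡ κ x → x ≼ y → y ≡ x) → upperCensus x ≤ + 1

    -- Γ-colored d-complete (local finiteness is automatic for finite P)
    DComplete : Set
    DComplete = EC × NA × AC × ICE2 × UCB1

    lowerSum : Fin size → Fin n → ℤ
    lowerSum y b = sumWhere (λ x → ltᵇ x y ∧ ⌊ adjacent? (κ x) (κ y) ⌋)
                            (λ x → - θ (κ x) b)

    LowerCensusIs : Fin n → ℤ → Set
    LowerCensusIs b k = Σ (Fin size) λ y →
      (κ y ≡ b) × (∀ z → κ z ≡ b → y ≼ z) × (lowerSum y b ≡ k)

  -- P is (isomorphic to) a filter of P' and P' ∖ P is a single element of color a
  IsOneElementExtension : CPoset → CPoset → Fin n → Set
  IsOneElementExtension P P' a =
    Σ (Fin (CPoset.size P) → Fin (CPoset.size P')) λ f →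
      (∀ x y → f x ≡ f y → x ≡ y) ×
      (∀ x y → (_≼_ P x y → _≼_ P' (f x) (f y)) × (_≼_ P' (f x) (f y) → _≼_ P x y)) ×
      (∀ x → CPoset.κ P' (f x) ≡ CPoset.κ P x) ×
      (∀ x y' → _≼_ P' (f x) y' → ∃ λ y → f y ≡ y') ×
      (Σ (Fin (CPoset.size P')) λ e →
         (CPoset.κ P' e ≡ a) ×
         (∀ x → f x ≢ e) ×
         (∀ y' → (y' ≡ e) ⊎ (∃ λ x → f x ≡ y')))

  ExtendableBy : CPoset → Fin n → Set
  ExtendableBy P a = Σ CPoset λ P' →
    Connected P' × DComplete P' × IsOneElementExtension P P' a

-- In a one-element extension by a new element e of colour a, (EC) and the filter property put e
-- directly below the least element y of colour a, and (AC) puts e below every element adjacent to a.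
-- So e < y is a consecutive pair of colour a, and up to elements of weight zero the interval (e, y)
-- is L(y, P); (ICE2) for this pair reads L_a(P) = 2. Conversely, if L_a(P) = 2, adjoin e below the
-- up-set generated by the elements of colour a or adjacent to a. The same computation gives (ICE2)
-- at (e, y); an element covering e must be adjacent to a, because one of colour a lies above y and
-- hence above the nonempty set L(y, P); the remaining axioms are inherited from P.

module Submission where

open import Defs
open import Data.Fin using (Fin)
open import Data.Integer using (+_)
open import Data.Product using (_×_)
open import Function.Bundles using (_⇔_)

open import Data.Bool using (Bool; true; false; T; if_then_else_; _∧_; not)
open import Data.Bool.Properties using (T-∧)
open import Data.Empty using (⊥-elim)
open import Data.Fin using (zero; suc)
import Data.Nat as ℕ
open import Data.Fin.Properties using (suc-injective; any?) renaming (_≟_ to _≟ᶠ_)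
open import Data.Integer using (ℤ; -_; _+_)
import Data.Integer.Properties as ℤ
open import Data.List using (List; []; _∷_; foldr; map; allFin)
open import Data.List.Properties using (map-cong)
open import Data.List.Membership.Propositional using (_∈_)
open import Data.List.Membership.Propositional.Properties using (∈-allFin; ∈-map⁺; ∈-map⁻)
open import Data.List.Membership.Propositional.Properties.WithK using (unique∧set⇒bag)
open import Data.List.Relation.Binary.BagAndSetEquality using (∼bag⇒↭)
open import Data.List.Relation.Binary.Permutation.Propositional using (_↭_; ↭⇒↭ₛ)
import Data.List.Relation.Binary.Permutation.Propositional.Properties as ↭
import Data.List.Relation.Binary.Permutation.Setoid.Properties as ↭ₛ
open import Data.List.Relation.Unary.AllPairs using (_∷_)
import Data.List.Relation.Unary.All as All
open import Data.List.Relation.Unary.Any using (here; there)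
import Data.List.Relation.Unary.Unique.Propositional.Properties as Unique
open import Data.Product using (∃; _,_; proj₁; proj₂)
open import Data.Sum using (_⊎_; inj₁; inj₂)
open import Function using (_∘_; id)
open import Function.Bundles using (mk⇔; Equivalence)
open import Relation.Nullary using (¬_; yes; no)
open import Relation.Nullary.Decidable using (⌊⌋-map′; ⌊_⌋; _×-dec_; _⊎-dec_; T?; toWitness; fromWitness; toWitnessFalse; fromWitnessFalse)
open import Relation.Unary using (Decidable)
open import Relation.Binary.PropositionalEquality
  using (_≡_; _≢_; refl; sym; trans; cong; cong₂; subst; subst₂; setoid; module ≡-Reasoning)
open import Relation.Binary.Construct.Closure.ReflexiveTransitive using (Star; ε; _◅_; _◅◅_; gmap)

open Equivalence using (to; from)

sumℤ : List ℤ → ℤ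
sumℤ = foldr _+_ (+ 0)

weight : Bool → ℤ → ℤ
weight b u = if b then u else + 0

weight-≡ : ∀ {b c u v} → (T b → T c → u ≡ v) → (T b → ¬ T c → u ≡ + 0) →
           (¬ T b → T c → v ≡ + 0) → weight b u ≡ weight c v
weight-≡ {true}  {true}  both _ _ = both _ _
weight-≡ {true}  {false} _ left _ = left _ id
weight-≡ {false} {true}  _ _ right = sym (right id _)
weight-≡ {false} {false} _ _ _ = refl

filteredSum : {A : Set} → (A → Bool) → (A → ℤ) → List A → ℤ
filteredSum p f = foldr (λ x acc → if p x then f x + acc else acc) (+ 0)

module _ {A : Set} where

  filteredSum≡sumℤ : ∀ (p : A → Bool) f xs → filteredSum p f xs ≡ sumℤ (map (λ x → weight (p x) (f x)) xs)
  filteredSum≡sumℤ p f [] = refl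
  filteredSum≡sumℤ p f (x ∷ xs) with p x
  ... | true  = cong (λ s → f x + s) (filteredSum≡sumℤ p f xs)
  ... | false = trans (filteredSum≡sumℤ p f xs) (sym (ℤ.+-identityˡ _))

  filteredSum-cong : ∀ {p q f g} → (∀ x → weight (p x) (f x) ≡ weight (q x) (g x)) →
                     ∀ xs → filteredSum p f xs ≡ filteredSum q g xs
  filteredSum-cong {p} {q} {f} {g} same xs = begin
    filteredSum p f xs                              ≡⟨ filteredSum≡sumℤ p f xs ⟩
    sumℤ (map (λ x → weight (p x) (f x)) xs)        ≡⟨ cong sumℤ (map-cong same xs) ⟩
    sumℤ (map (λ x → weight (q x) (g x)) xs)        ≡⟨ filteredSum≡sumℤ q g xs ⟨
    filteredSum q g xs                              ∎
    where open ≡-Reasoning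

  filteredSum-↭ : ∀ p f {xs ys} → xs ↭ ys → filteredSum p f xs ≡ filteredSum p f ys
  filteredSum-↭ p f {xs} {ys} xs↭ys = begin
    filteredSum p f xs       ≡⟨ filteredSum≡sumℤ p f xs ⟩
    sumℤ (map w xs)          ≡⟨ ↭ₛ.foldr-commMonoid (setoid ℤ) ℤ.+-0-isCommutativeMonoid
                                  (↭⇒↭ₛ (↭.map⁺ w xs↭ys)) ⟩
    sumℤ (map w ys)          ≡⟨ filteredSum≡sumℤ p f ys ⟨
    filteredSum p f ys       ∎
    where
    open ≡-Reasoning
    w = λ x → weight (p x) (f x)

  filteredSum-map : ∀ {B : Set} p f (h : B → A) xs →
                    filteredSum p f (map h xs) ≡ filteredSum (p ∘ h) (f ∘ h) xs
  filteredSum-map p f h []       = refl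
  filteredSum-map p f h (x ∷ xs) =
    cong (λ s → if p (h x) then f (h x) + s else s) (filteredSum-map p f h xs)

  filteredSum-skip : ∀ (p : A → Bool) f {x} xs → ¬ T (p x) → filteredSum p f (x ∷ xs) ≡ filteredSum p f xs
  filteredSum-skip p f {x} xs ¬px with p x
  ... | true  = ⊥-elim (¬px _)
  ... | false = refl

  filteredSum-witness : ∀ (p : A → Bool) f xs → filteredSum p f xs ≢ + 0 → ∃ λ x → T (p x)
  filteredSum-witness p f []       nonzero = ⊥-elim (nonzero refl)
  filteredSum-witness p f (x ∷ xs) nonzero with p x in px
  ... | true  = x , subst T (sym px) _
  ... | false = filteredSum-witness p f xs nonzero

module _ (Γ : Dynkin) where
  open Dynkin Γ

  Adjacent-sym : ∀ {a b} → Adjacent Γ a b → Adjacent Γ b a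
  Adjacent-sym {a} {b} (a≢b , θab<0) =
    (a≢b ∘ sym) , ℤ.≤∧≢⇒< (θ-off b a (a≢b ∘ sym)) (λ θba≡0 → ℤ.<-irrefl (θ-zero← a b θba≡0) θab<0)

  nonadjacent⇒-θ≡0 : ∀ {a b} → a ≢ b → ¬ Adjacent Γ a b → - θ a b ≡ + 0
  nonadjacent⇒-θ≡0 {a} {b} a≢b ¬adj =
    cong -_ (ℤ.≤-antisym (θ-off a b a≢b) (ℤ.≮⇒≥ (λ θab<0 → ¬adj (a≢b , θab<0))))

module Order {Γ : Dynkin} (P : CPoset Γ) where
  open Dynkin Γ using (θ)
  open CPoset P public

  infix 4 _⊑_ _⊏_

  _⊑_ : Fin size → Fin size → Set
  _⊑_ = _≼_ Γ P

  _⊏_ : Fin size → Fin size → Set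
  _⊏_ = _≺_ Γ P

  ltᵇ⇒⊏ : ∀ {x y} → T (ltᵇ Γ P x y) → x ⊏ y
  ltᵇ⇒⊏ t = let x⊑y , x≢y = T-∧ .to t in x⊑y , toWitnessFalse x≢y

  ⊏⇒ltᵇ : ∀ {x y} → x ⊏ y → T (ltᵇ Γ P x y)
  ⊏⇒ltᵇ (x⊑y , x≢y) = T-∧ .from (x⊑y , fromWitnessFalse x≢y)

  ⊏-irrefl : ∀ {x} → ¬ x ⊏ x
  ⊏-irrefl (_ , x≢x) = x≢x refl

  ⊏-⊑-trans : ∀ {x y z} → x ⊏ y → y ⊑ z → x ⊏ z
  ⊏-⊑-trans {x} {y} {z} (x⊑y , x≢y) y⊑z =
    ≤-trans x y z x⊑y y⊑z , λ { refl → x≢y (≤-antisym x y x⊑y y⊑z) }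

  module _ {Q : Fin size → Set} (Q? : Decidable Q)
           (chain : ∀ x y → Q x → Q y → Comparable Γ P x y) where

    least-below : ∀ c → Q c → (xs : List (Fin size)) →
                  ∃ λ r → Q r × r ⊑ c × (∀ z → z ∈ xs → Q z → r ⊑ z)
    least-below c Qc [] = c , Qc , ≤-refl c , λ _ ()
    least-below c Qc (x ∷ xs) with Q? x
    ... | no ¬Qx =
      let r , Qr , r⊑c , r-least = least-below c Qc xs
      in r , Qr , r⊑c , λ { z (here refl) Qz → ⊥-elim (¬Qx Qz) ; z (there z∈xs) → r-least z z∈xs }
    ... | yes Qx with chain x c Qx Qc
    ...   | inj₁ x⊑c =
      let r , Qr , r⊑x , r-least = least-below x Qx xs
      in r , Qr , ≤-trans r x c r⊑x x⊑c , λ { z (here refl) _ → r⊑x ; z (there z∈xs) → r-least z z∈xs }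
    ...   | inj₂ c⊑x =
      let r , Qr , r⊑c , r-least = least-below c Qc xs
      in r , Qr , r⊑c , λ { z (here refl) _ → ≤-trans r c z r⊑c c⊑x ; z (there z∈xs) → r-least z z∈xs }

    least : ∃ Q → ∃ λ r → Q r × (∀ z → Q z → r ⊑ z)
    least (c , Qc) =
      let r , Qr , _ , r-least = least-below c Qc (allFin size)
      in r , Qr , λ z → r-least z (∈-allFin z)

  least-of-colour : EC Γ P → ∀ a → ∃ λ y → κ y ≡ a × (∀ z → κ z ≡ a → y ⊑ z)
  least-of-colour ec a =
    least (λ z → κ z ≟ᶠ a) (λ x y κx κy → ec x y (trans κx (sym κy))) (κ-surj a)

  below-least-weight : ∀ {a y z} → κ y ≡ a → (∀ w → κ w ≡ a → y ⊑ w) → z ⊏ y →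
                       ¬ Adjacent Γ (κ z) (κ y) → - θ (κ z) a ≡ + 0
  below-least-weight {y = y} {z} refl y-least (z⊑y , z≢y) ¬adj =
    nonadjacent⇒-θ≡0 Γ (λ κz≡κy → z≢y (≤-antisym z y z⊑y (y-least z κz≡κy))) ¬adj

module Extension {Γ : Dynkin} (P P' : CPoset Γ) {a : Fin (Dynkin.n Γ)}
  (f          : Fin (CPoset.size P) → Fin (CPoset.size P'))
  (f-injective : ∀ x y → f x ≡ f y → x ≡ y)
  (f-order    : ∀ x y → (_≼_ Γ P x y → _≼_ Γ P' (f x) (f y)) × (_≼_ Γ P' (f x) (f y) → _≼_ Γ P x y))
  (f-colour   : ∀ x → CPoset.κ P' (f x) ≡ CPoset.κ P x)
  (f-filter   : ∀ x y' → _≼_ Γ P' (f x) y' → ∃ λ y → f y ≡ y')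
  (e          : Fin (CPoset.size P'))
  (e-colour   : CPoset.κ P' e ≡ a)
  (e-fresh    : ∀ x → f x ≢ e)
  (e-cover    : ∀ y' → (y' ≡ e) ⊎ (∃ λ x → f x ≡ y'))
  where

  open Dynkin Γ using (θ)
  open Order P
  private module P' = Order P'

  f-⊏ : ∀ {x y} → x ⊏ y → f x P'.⊏ f y
  f-⊏ {x} {y} (x⊑y , x≢y) = proj₁ (f-order x y) x⊑y , x≢y ∘ f-injective x y

  f-⊏⁻ : ∀ {x y} → f x P'.⊏ f y → x ⊏ y
  f-⊏⁻ {x} {y} (fx⊑fy , fx≢fy) = proj₂ (f-order x y) fx⊑fy , fx≢fy ∘ cong f

  enumeration : allFin P'.size ↭ e ∷ map f (allFin size)
  enumeration = ∼bag⇒↭ (unique∧set⇒bag (Unique.allFin⁺ P'.size) unique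
                          (mk⇔ (λ _ → listed _) (λ _ → ∈-allFin _)))
    where
    unique = All.tabulate (λ fx∈ e≡fx → let x , _ , fx≡ = ∈-map⁻ f fx∈ in e-fresh x (sym (trans e≡fx fx≡)))
           ∷ Unique.map⁺ (f-injective _ _) (Unique.allFin⁺ size)
    listed : ∀ y' → y' ∈ e ∷ map f (allFin size)
    listed y' with e-cover y'
    ... | inj₁ refl       = here refl
    ... | inj₂ (x , refl) = there (∈-map⁺ f (∈-allFin x))

  sumWhere-extension : ∀ p g → ¬ T (p e) → sumWhere Γ P' p g ≡ sumWhere Γ P (p ∘ f) (g ∘ f)
  sumWhere-extension p g ¬pe = begin
    filteredSum p g (allFin P'.size)               ≡⟨ filteredSum-↭ p g enumeration ⟩
    filteredSum p g (e ∷ map f (allFin size))      ≡⟨ filteredSum-skip p g (map f (allFin size)) ¬pe ⟩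
    filteredSum p g (map f (allFin size))          ≡⟨ filteredSum-map p g f (allFin size) ⟩
    filteredSum (p ∘ f) (g ∘ f) (allFin size)      ∎
    where open ≡-Reasoning

  new-below : ∀ {x} → Comparable Γ P' e (f x) → e P'.⊏ f x
  new-below {x} (inj₁ e⊑fx) = e⊑fx , λ e≡fx → e-fresh x (sym e≡fx)
  new-below {x} (inj₂ fx⊑e) = let z , fz≡e = f-filter x e fx⊑e in ⊥-elim (e-fresh z fz≡e)

  interval-census : ∀ y → κ y ≡ a → (∀ z → κ z ≡ a → y ⊑ z) →
                    (∀ z → z ⊏ y → Adjacent Γ (κ z) (κ y) → e P'.⊏ f z) →
                    sumWhere Γ P' (λ w → ltᵇ Γ P' e w ∧ ltᵇ Γ P' w (f y)) (λ w → - θ (P'.κ w) (P'.κ e))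
                      ≡ lowerSum Γ P y a
  interval-census y κy y-least L⊏ =
    trans (sumWhere-extension interval (λ w → - θ (P'.κ w) (P'.κ e)) e∉interval)
          (filteredSum-cong {p = interval ∘ f} {inL} same-weight (allFin size))
    where
    interval : Fin P'.size → Bool
    interval w = ltᵇ Γ P' e w ∧ ltᵇ Γ P' w (f y)

    inL : Fin size → Bool
    inL z = ltᵇ Γ P z y ∧ ⌊ adjacent? Γ (κ z) (κ y) ⌋

    e∉interval : ¬ T (interval e)
    e∉interval = P'.⊏-irrefl ∘ P'.ltᵇ⇒⊏ ∘ proj₁ ∘ T-∧ .to

    same-colours : ∀ z → - θ (P'.κ (f z)) (P'.κ e) ≡ - θ (κ z) a
    same-colours z = cong₂ (λ b c → - θ b c) (f-colour z) e-colour

    zero-weight : ∀ z → T (interval (f z)) → ¬ T (inL z) → - θ (P'.κ (f z)) (P'.κ e) ≡ + 0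
    zero-weight z fz∈interval z∉L =
      let z⊏y = f-⊏⁻ (P'.ltᵇ⇒⊏ (proj₂ (T-∧ {ltᵇ Γ P' e (f z)} .to fz∈interval)))
      in trans (same-colours z)
               (below-least-weight κy y-least z⊏y
                  (λ adj → z∉L (T-∧ {ltᵇ Γ P z y} .from (⊏⇒ltᵇ z⊏y , fromWitness adj))))

    absent : ∀ z → ¬ T (interval (f z)) → T (inL z) → - θ (κ z) a ≡ + 0
    absent z fz∉interval z∈L =
      let z⊏y , adj = T-∧ .to z∈L
      in ⊥-elim (fz∉interval (T-∧ {ltᵇ Γ P' e (f z)} .from
                   (P'.⊏⇒ltᵇ (L⊏ z (ltᵇ⇒⊏ z⊏y) (toWitness adj)) , P'.⊏⇒ltᵇ (f-⊏ (ltᵇ⇒⊏ z⊏y)))))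

    same-weight : ∀ z → weight (interval (f z)) (- θ (P'.κ (f z)) (P'.κ e)) ≡ weight (inL z) (- θ (κ z) a)
    same-weight z = weight-≡ (λ _ _ → same-colours z) (zero-weight z) (absent z)

  colour-of-new : ∀ {x} → κ x ≡ a → P'.κ e ≡ P'.κ (f x)
  colour-of-new {x} κx = trans e-colour (sym (trans (f-colour x) κx))

  new-below-colour : EC Γ P' → ∀ {x} → κ x ≡ a → e P'.⊏ f x
  new-below-colour ec' {x} κx = new-below (ec' e (f x) (colour-of-new κx))

  new-below-adjacent : AC Γ P' → ∀ {x} → Adjacent Γ (κ x) a → e P'.⊏ f x
  new-below-adjacent ac' {x} adj =
    new-below (ac' e (f x) (subst₂ (Adjacent Γ) (sym e-colour) (sym (f-colour x)) (Adjacent-sym Γ adj)))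

  none-of-colour-between : ∀ y → (∀ z → κ z ≡ a → y ⊑ z) →
                           ∀ w → e P'.⊏ w → w P'.⊏ f y → P'.κ w ≢ P'.κ e
  none-of-colour-between y y-least w e⊏w w⊏fy κw≡κe with e-cover w
  ... | inj₁ refl       = P'.⊏-irrefl e⊏w
  ... | inj₂ (z , refl) =
    ⊏-irrefl (⊏-⊑-trans (f-⊏⁻ w⊏fy) (y-least z (trans (sym (f-colour z)) (trans κw≡κe e-colour))))

extendable⇒census : ∀ {Γ : Dynkin} (P : CPoset Γ) {a} → EC Γ P →
                    ExtendableBy Γ P a → LowerCensusIs Γ P a (+ 2)
extendable⇒census {Γ} P {a} ec
  (P' , _ , (ec' , _ , ac' , ice2' , _) , f , f-inj , f-ord , f-col , f-filter , e , e-col , e-fresh , e-cover) =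
  let y , κy , y-least = least-of-colour ec a
      L⊏new = λ z _ adj → new-below-adjacent ac' (subst (Adjacent Γ (κ z)) κy adj)
  in y , κy , y-least , (begin
    lowerSum Γ P y a
      ≡⟨ interval-census y κy y-least L⊏new ⟨
    sumWhere Γ P' (λ w → ltᵇ Γ P' e w ∧ ltᵇ Γ P' w (f y)) (λ w → - θ (P'.κ w) (P'.κ e))
      ≡⟨ ice2' e (f y) (new-below-colour ec' κy) (colour-of-new κy) (none-of-colour-between y y-least) ⟩
    + 2 ∎)
  where
  open Dynkin Γ using (θ)
  open Order P
  module P' = CPoset P'
  open Extension P P' f f-inj f-ord f-col f-filter e e-col e-fresh e-cover
  open ≡-Reasoning

module AdjoinBelow {Γ : Dynkin} (P : CPoset Γ) (c : Fin (Dynkin.n Γ))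
                   {G : Fin (CPoset.size P) → Set} (G? : Decidable G) where
  open Order P

  Above : Fin size → Set
  Above w = ∃ λ z → G z × z ⊑ w

  above? : Decidable Above
  above? w = any? (λ z → G? z ×-dec T? (leᵇ z w))

  leᵇ⁺ : Fin (ℕ.suc size) → Fin (ℕ.suc size) → Bool
  leᵇ⁺ zero    zero    = true
  leᵇ⁺ zero    (suc w) = ⌊ above? w ⌋
  leᵇ⁺ (suc x) zero    = false
  leᵇ⁺ (suc x) (suc w) = leᵇ x w

  ≤⁺-refl : ∀ x → T (leᵇ⁺ x x)
  ≤⁺-refl zero    = _
  ≤⁺-refl (suc x) = ≤-refl x

  ≤⁺-antisym : ∀ x w → T (leᵇ⁺ x w) → T (leᵇ⁺ w x) → x ≡ w
  ≤⁺-antisym zero    zero    _   _   = refl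
  ≤⁺-antisym (suc x) (suc w) x⊑w w⊑x = cong suc (≤-antisym x w x⊑w w⊑x)

  ≤⁺-trans : ∀ x w v → T (leᵇ⁺ x w) → T (leᵇ⁺ w v) → T (leᵇ⁺ x v)
  ≤⁺-trans zero    zero    v       _   e⊑v = e⊑v
  ≤⁺-trans zero    (suc w) (suc v) e⊑w w⊑v =
    let z , Gz , z⊑w = toWitness e⊑w in fromWitness (z , Gz , ≤-trans z w v z⊑w w⊑v)
  ≤⁺-trans (suc x) (suc w) (suc v) x⊑w w⊑v = ≤-trans x w v x⊑w w⊑v

  κ⁺ : Fin (ℕ.suc size) → Fin (Dynkin.n Γ)
  κ⁺ zero    = c
  κ⁺ (suc x) = κ x

  P⁺ : CPoset Γ
  P⁺ = record
    { size = ℕ.suc size ; leᵇ = leᵇ⁺ ; ≤-refl = ≤⁺-refl ; ≤-antisym = ≤⁺-antisym ; ≤-trans = ≤⁺-trans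
    ; κ = κ⁺ ; κ-surj = λ b → let x , κx = κ-surj b in suc x , κx }

  module P⁺ = Order P⁺

  suc-filter : ∀ x y' → suc x P⁺.⊑ y' → ∃ λ y → suc y ≡ y'
  suc-filter x (suc y) _ = y , refl

  cover : ∀ (y' : Fin (ℕ.suc size)) → (y' ≡ zero) ⊎ (∃ λ x → suc x ≡ y')
  cover zero    = inj₁ refl
  cover (suc x) = inj₂ (x , refl)

  extension : IsOneElementExtension Γ P P⁺ c
  extension = suc , (λ _ _ → suc-injective) , (λ _ _ → id , id) , (λ _ → refl) , suc-filter
            , zero , refl , (λ _ ()) , cover

  open Extension P P⁺ suc (λ _ _ → suc-injective) (λ _ _ → id , id) (λ _ → refl) suc-filter
                 zero refl (λ _ ()) cover
    public using (sumWhere-extension; interval-census)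

  ltᵇ-suc : ∀ x z → ltᵇ Γ P⁺ (suc x) (suc z) ≡ ltᵇ Γ P x z
  ltᵇ-suc x z = cong (λ b → leᵇ x z ∧ not b) (⌊⌋-map′ (cong suc) suc-injective (x ≟ᶠ z))

  sumWhere-lift : ∀ p q g → ¬ T (p zero) → (∀ z → p (suc z) ≡ q z) →
                  sumWhere Γ P⁺ p g ≡ sumWhere Γ P q (g ∘ suc)
  sumWhere-lift p q g ¬p0 p∘suc≡q =
    trans (sumWhere-extension p g ¬p0)
          (filteredSum-cong {p = p ∘ suc} {q} (λ z → cong (λ b → weight b (g (suc z))) (p∘suc≡q z))
                            (allFin size))

  suc-⊏ : ∀ {x w} → x ⊏ w → suc x P⁺.⊏ suc w
  suc-⊏ (x⊑w , x≢w) = x⊑w , x≢w ∘ suc-injective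

  suc-⊏⁻ : ∀ {x w} → suc x P⁺.⊏ suc w → x ⊏ w
  suc-⊏⁻ (x⊑w , sx≢sw) = x⊑w , sx≢sw ∘ cong suc

  new-⊏ : ∀ {x} → G x → zero P⁺.⊏ suc x
  new-⊏ {x} Gx = fromWitness (x , Gx , ≤-refl x) , λ ()

  connected : Connected Γ P → ∀ {y} → G y → Connected Γ P⁺
  connected conn {y} Gy = conn⁺
    where
    lift : ∀ {x w} → Star (Comparable Γ P) x w → Star (Comparable Γ P⁺) (suc x) (suc w)
    lift = gmap suc id
    conn⁺ : Connected Γ P⁺
    conn⁺ zero    zero    = ε
    conn⁺ zero    (suc w) = inj₁ (proj₁ (new-⊏ Gy)) ◅ lift (conn y w)
    conn⁺ (suc x) zero    = lift (conn x y) ◅◅ (inj₂ (proj₁ (new-⊏ Gy)) ◅ ε)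
    conn⁺ (suc x) (suc w) = lift (conn x w)

  not-covering : ∀ {x w} → G x → x ⊏ w → ¬ Covers Γ P⁺ zero (suc w)
  not-covering Gx x⊏w (_ , nothing-between) = nothing-between (suc _) (new-⊏ Gx , suc-⊏ x⊏w)

  covered-by-new : ∀ {w} → Covers Γ P⁺ zero (suc w) → G w
  covered-by-new {w} cover@((e⊑w , _) , _) with toWitness e⊑w
  ... | z , Gz , z⊑w with z ≟ᶠ w
  ...   | yes refl = Gz
  ...   | no z≢w   = ⊥-elim (not-covering Gz (z⊑w , z≢w) cover)

module Backward {Γ : Dynkin} (P : CPoset Γ)
  (ec : EC Γ P) (na : NA Γ P) (ac : AC Γ P) (ice2 : ICE2 Γ P) (ucb1 : UCB1 Γ P)
  (y : Fin (CPoset.size P)) (y-least : ∀ z → CPoset.κ P z ≡ CPoset.κ P y → _≼_ Γ P y z)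
  (census : lowerSum Γ P y (CPoset.κ P y) ≡ + 2) where

  open Dynkin Γ using (θ)
  open Order P

  Relevant : Fin size → Set
  Relevant z = κ z ≡ κ y ⊎ Adjacent Γ (κ z) (κ y)

  relevant? : Decidable Relevant
  relevant? z = κ z ≟ᶠ κ y ⊎-dec adjacent? Γ (κ z) (κ y)

  open AdjoinBelow P (κ y) relevant?

  adjacent-below : ∃ λ x → x ⊏ y × Adjacent Γ (κ x) (κ y)
  adjacent-below =
    let x , x∈L = filteredSum-witness (λ x → ltᵇ Γ P x y ∧ ⌊ adjacent? Γ (κ x) (κ y) ⌋)
                                      (λ x → - θ (κ x) (κ y)) (allFin size)
                                      (λ census≡0 → 2≢0 (trans (sym census) census≡0))
        x<y , adj = T-∧ {ltᵇ Γ P x y} .to x∈L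
    in x , ltᵇ⇒⊏ x<y , toWitness adj
    where
    2≢0 : + 2 ≢ + 0
    2≢0 ()

  ec⁺ : EC Γ P⁺
  ec⁺ zero    zero    _   = inj₁ _
  ec⁺ zero    (suc w) κ≡  = inj₁ (proj₁ (new-⊏ (inj₁ (sym κ≡))))
  ec⁺ (suc x) zero    κ≡  = inj₂ (proj₁ (new-⊏ (inj₁ κ≡)))
  ec⁺ (suc x) (suc w) κ≡  = ec x w κ≡

  na⁺ : NA Γ P⁺
  na⁺ zero    zero    (e⊏e , _) = ⊥-elim (P⁺.⊏-irrefl e⊏e)
  na⁺ (suc x) zero    ((() , _) , _)
  na⁺ (suc x) (suc w) (x⊏w , nothing-between) =
    na x w (suc-⊏⁻ x⊏w , λ z (x⊏z , z⊏w) → nothing-between (suc z) (suc-⊏ x⊏z , suc-⊏ z⊏w))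
  na⁺ zero    (suc w) covers with covered-by-new covers
  ... | inj₂ adj   = Adjacent-sym Γ adj
  ... | inj₁ κw≡κy =
    let x , x⊏y , adj = adjacent-below
    in ⊥-elim (not-covering (inj₂ adj) (⊏-⊑-trans x⊏y (y-least w κw≡κy)) covers)

  ac⁺ : AC Γ P⁺
  ac⁺ zero    zero    (c≢c , _) = ⊥-elim (c≢c refl)
  ac⁺ zero    (suc w) adj       = inj₁ (proj₁ (new-⊏ (inj₂ (Adjacent-sym Γ adj))))
  ac⁺ (suc x) zero    adj       = inj₂ (proj₁ (new-⊏ (inj₂ adj)))
  ac⁺ (suc x) (suc w) adj       = ac x w adj

  ice2⁺ : ICE2 Γ P⁺
  ice2⁺ zero    zero    e⊏e _ _ = ⊥-elim (P⁺.⊏-irrefl e⊏e)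
  ice2⁺ (suc x) zero    (() , _) _ _
  ice2⁺ (suc x) (suc w) x⊏w κ≡ between =
    trans (sumWhere-lift (λ z → ltᵇ Γ P⁺ (suc x) z ∧ ltᵇ Γ P⁺ z (suc w)) (λ z → ltᵇ Γ P x z ∧ ltᵇ Γ P z w)
                         (λ z → - θ (κ⁺ z) (κ x)) (λ ())
                         (λ z → cong₂ _∧_ (ltᵇ-suc x z) (ltᵇ-suc z w)))
          (ice2 x w (suc-⊏⁻ x⊏w) κ≡ (λ z x⊏z z⊏w → between (suc z) (suc-⊏ x⊏z) (suc-⊏ z⊏w)))
  ice2⁺ zero    (suc w) _   κ≡ between with y ≟ᶠ w
  ... | yes refl = trans (interval-census y refl y-least (λ _ _ adj → new-⊏ (inj₂ adj))) census
  ... | no y≢w   = ⊥-elim (between (suc y) (new-⊏ (inj₁ refl)) (suc-⊏ (y-least w (sym κ≡) , y≢w)) refl)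

  ucb1⁺ : UCB1 Γ P⁺
  ucb1⁺ zero    maximal with maximal (suc y) refl (proj₁ (new-⊏ (inj₁ refl)))
  ... | ()
  ucb1⁺ (suc x) maximal =
    ℤ.≤-trans (ℤ.≤-reflexive (sumWhere-lift (λ z → ltᵇ Γ P⁺ (suc x) z ∧ ⌊ adjacent? Γ (κ⁺ z) (κ x) ⌋) _
                                             (λ z → - θ (κ⁺ z) (κ x)) (λ ())
                               (λ z → cong (_∧ ⌊ adjacent? Γ (κ z) (κ x) ⌋) (ltᵇ-suc x z))))
              (ucb1 x (λ w κw x⊑w → suc-injective (maximal (suc w) κw x⊑w)))

  extendable : Connected Γ P → ExtendableBy Γ P (κ y)
  extendable conn = P⁺ , connected conn (inj₁ refl) , (ec⁺ , na⁺ , ac⁺ , ice2⁺ , ucb1⁺) , extension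

lemma6p5 : (Γ : Dynkin) (P : CPoset Γ) → Connected Γ P → DComplete Γ P →
           (a : Fin (Dynkin.n Γ)) →
           ExtendableBy Γ P a ⇔ LowerCensusIs Γ P a (+ 2)
lemma6p5 Γ P conn (ec , na , ac , ice2 , ucb1) a = mk⇔ (extendable⇒census P ec) census⇒extendable
  where
  census⇒extendable : LowerCensusIs Γ P a (+ 2) → ExtendableBy Γ P a
  census⇒extendable (y , refl , y-least , census) =
    Backward.extendable P ec na ac ice2 ucb1 y y-least census conn
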